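{- Let $q$ be an odd prime power and let $f_0(x), f_1(x) \in \mathbb{F}_q[x]$. Define $$f(x) = \tfrac{1}{2}f_0(x)\left(1 + x^{\frac{q-1}{2}}\right) + \tfrac{1}{2}f_1(x)\left(1 - x^{\frac{q-1}{2}}\right),$$ and assume $f(0) = 0$. Let $C_0 = \{e^2 : e \in \mathbb{F}_q^*\}$ and $C_1 = \mathbb{F}_q^* \setminus C_0$. Then $f(x)$ is a permutation polynomial of $\mathbb{F}_q$ if and only if all of the following hold: - $f_s$ is injective on $C_s$ for $s \in \{0,1\}$; - $0 \notin f_s(C_s)$ for $s \in \{0,1\}$; - $f_0(C_0) \cap f_1(C_1) = \emptyset$. Assume now that $f(x)$ is a permutation polynomial of $\mathbb{F}_q$. For $s \in \{0,1\}$, let $f_s^{ -1}(x) \in \mathbb{F}_q[x]$ satisfy $f_s^{ -1}(0) = 0$ and $f_s^{ -1}(f_s(c)) = c$ for every $c \in C_s$. (i) If $f_s$ maps $C_s$ into $C_s$ for both $s \in \{0,1\}$, then the inverse of $f(x)$ on $\mathbb{F}_q$ is $$f^{ -1}(x) = \tfrac{1}{2}f_0^{ -1}(x)\left(1 + x^{\frac{q-1}{2}}\right) + \tfrac{1}{2}f_1^{ -1}(x)\left(1 - x^{\frac{q-1}{2}}\right).$$ (ii) If $f_s$ maps $C_s$ into $C_t$ with $s \neq t$ for both $s \in \{0,1\}$, then the inverse of $f(x)$ on $\mathbb{F}_q$ is $$f^{ -1}(x) = \tfrac{1}{2}f_0^{ -1}(x)\left(1 - x^{\frac{q-1}{2}}\right)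 + \tfrac{1}{2}f_1^{ -1}(x)\left(1 + x^{\frac{q-1}{2}}\right).$$
   Context: A permutation polynomial of $\mathbb{F}_q$ is a polynomial inducing a bijection of $\mathbb{F}_q$. Its inverse on $\mathbb{F}_q$ is a polynomial $g$ with $g(f(c)) = c$ for all $c \in \mathbb{F}_q$ (unique modulo $x^q - x$). -}

module Defs where

open import Level using (0ℓ)
open import Data.Nat using (ℕ; zero; suc; _∸_; _/_) renaming (_^_ to _^ℕ_)
open import Data.Nat.Primality using (Prime)
open import Data.Fin using (Fin)
open import Data.List using (List; []; _∷_; map; replicate; _++_; foldr)
open import Data.Product using (Σ; ∃; _×_; _,_)
open import Relation.Binary.PropositionalEquality using (_≡_; _≢_)
open import Relation.Nullary using (¬_)
open import Function.Bundles using (_↔_)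
open import Function.Definitions using (Bijective)
open import Algebra.Structures using (IsCommutativeRing)

OddPrimePower : ℕ → Set
OddPrimePower q = Σ ℕ λ p → Σ ℕ λ k → Prime p × p ≢ 2 × q ≡ p ^ℕ suc k

record FiniteField (q : ℕ) : Set₁ where
  infixl 6 _+_
  infixl 7 _*_
  field
    Carrier : Set
    _+_ _*_ : Carrier → Carrier → Carrier
    -_      : Carrier → Carrier
    0# 1#   : Carrier
    _⁻¹     : Carrier → Carrier
    isCommutativeRing : IsCommutativeRing _≡_ _+_ _*_ -_ 0# 1#
    0≢1     : 0# ≢ 1#
    ⁻¹-inverse : ∀ x → x ≢ 0# → x * (x ⁻¹) ≡ 1#
    enumeration : Carrier ↔ Fin q

  _^_ : Carrier → ℕ → Carrier
  x ^ zero  = 1#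
  x ^ suc n = x * (x ^ n)

  half : Carrier
  half = (1# + 1#) ⁻¹

  -- polynomials over the field, as coefficient lists (lowest degree first)
  Poly : Set
  Poly = List Carrier

  eval : Poly → Carrier → Carrier
  eval p c = foldr (λ a acc → a + c * acc) 0# p

  infixl 6 _+ₚ_
  infixl 7 _*ₚ_
  _+ₚ_ : Poly → Poly → Poly
  [] +ₚ r = r
  (a ∷ p) +ₚ [] = a ∷ p
  (a ∷ p) +ₚ (b ∷ r) = (a + b) ∷ (p +ₚ r)

  scaleₚ : Carrier → Poly → Poly
  scaleₚ a p = map (a *_) p

  _*ₚ_ : Poly → Poly → Poly
  [] *ₚ r = []
  (a ∷ p) *ₚ r = scaleₚ a r +ₚ (0# ∷ (p *ₚ r))

  -ₚ_ : Poly → Poly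
  -ₚ p = map -_ p

  constₚ : Carrier → Poly
  constₚ a = a ∷ []

  Xpow : ℕ → Poly
  Xpow n = replicate n 0# ++ (1# ∷ [])

  Xhalf : Poly
  Xhalf = Xpow ((q ∸ 1) / 2)

  piecewise : Poly → Poly → Poly
  piecewise g0 g1 =
    constₚ half *ₚ g0 *ₚ (constₚ 1# +ₚ Xhalf)
    +ₚ constₚ half *ₚ g1 *ₚ (constₚ 1# +ₚ (-ₚ Xhalf))

  C₀ : Carrier → Set
  C₀ c = ∃ λ e → e ≢ 0# × c ≡ e * e

  C₁ : Carrier → Set
  C₁ c = c ≢ 0# × ¬ C₀ c

  IsPermutationPolynomial : Poly → Set
  IsPermutationPolynomial p = Bijective _≡_ _≡_ (eval p)

  IsInverseOn : Poly → Poly → Set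
  IsInverseOn g f = ∀ c → eval g (eval f c) ≡ c

  InjectiveOn : (Carrier → Set) → Poly → Set
  InjectiveOn C p = ∀ a b → C a → C b → eval p a ≡ eval p b → a ≡ b

  MapsInto : Poly → (Carrier → Set) → (Carrier → Set) → Set
  MapsInto p C D = ∀ c → C c → D (eval p c)

  IsPartialInverse : Poly → Poly → (Carrier → Set) → Set
  IsPartialInverse g p C = eval g 0# ≡ 0# × (∀ c → C c → eval g (eval p c) ≡ c)

{-# OPTIONS --safe #-}
module Submission where

-- Euler's criterion: for c ≠ 0, c^((q-1)/2) is 1 if c is a square and -1 otherwise.  Hence
-- f agrees with f₀ on C₀ and with f₁ on C₁, and both parts of the theorem reduce to
-- splitting F_q into {0}, C₀ and C₁.  Euler's criterion is proved by Wilson's pairing: for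
-- c ≠ 0, y ↦ c/y is an involution of F_q^* whose fixed points are the square roots of c, so
-- the product of all nonzero elements is c^((q-1)/2) when c is a non-square and, the roots
-- e and -e contributing -c, equals -c^((q-1)/2) when c = e²; for c = 1 this product is -1.

open import Level using (Level)
open import Data.Nat as ℕ using (ℕ; zero; suc; _∸_; _/_; _<_)
import Data.Nat.Properties as ℕ
open import Data.Nat.Divisibility using (_∣_; divides)
open import Data.Nat.DivMod using (m*n/n≡m)
open import Data.Nat.Induction using (<-wellFounded)
open import Data.Nat.Primality using (Prime; euclidsLemma; prime[2]; prime⇒irreducible)
open import Data.Fin using (Fin; punchOut)
import Data.Fin.Properties as Fin
open import Data.Product using (∃; _×_; _,_; proj₁; proj₂)
open import Data.Sum using (_⊎_; inj₁; inj₂)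
open import Data.Empty using (⊥-elim)
open import Data.List using (List; []; _∷_; _++_; length; map; foldr; allFin)
open import Data.List.Properties using (length-map; length-tabulate)
import Data.List.Relation.Unary.All as All
open import Data.List.Relation.Unary.Any as Any using (here; there)
open import Data.List.Relation.Unary.AllPairs using (_∷_)
open import Data.List.Relation.Unary.Unique.Propositional using (Unique)
import Data.List.Relation.Unary.Unique.Propositional.Properties as Unique
open import Data.List.Membership.Propositional using (_∈_; _∉_)
open import Data.List.Membership.Propositional.Properties
  using (∈-∃++; ∈-++⁺ʳ; ∈-++⁻; ∈-map⁺; ∈-allFin)
open import Data.List.Relation.Binary.Permutation.Propositional
  using (_↭_; ↭-refl; ↭-sym; ↭-trans; ↭-prep; ↭⇒↭ₛ)
open import Data.List.Relation.Binary.Permutation.Propositional.Properties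
  using (∈-resp-↭; ↭-length; shift)
import Data.List.Relation.Binary.Permutation.Setoid.Properties as Permutationₛ
open import Function using (_∘_; id)
open import Function.Bundles using (_↔_; Inverse; Injection; _⇔_; mk⇔)
open import Function.Definitions using (Injective; StrictlySurjective; Bijective)
open import Function.Consequences.Propositional using (strictlySurjective⇒surjective)
open import Function.Properties.Inverse using (↔⇒↣; ↔-sym)
open import Induction.WellFounded using (Acc; acc)
open import Relation.Binary.PropositionalEquality
open import Relation.Binary.Definitions using (DecidableEquality)
open import Relation.Nullary using (Dec; yes; no)
open import Relation.Nullary.Decidable using (¬?; _×-dec_)
open import Algebra.Bundles using (CommutativeRing)
open import Algebra.Structures using (IsCommutativeRing)

open import Defs

private
  variable
    a : Level
    A : Set a

∣^suc⇒∣ : ∀ {d p} k → Prime d → d ∣ p ℕ.^ suc k → d ∣ p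
∣^suc⇒∣ zero    prime-d d∣p^1 = subst (_ ∣_) (ℕ.*-identityʳ _) d∣p^1
∣^suc⇒∣ (suc k) prime-d d∣p^k+2 with euclidsLemma _ _ prime-d d∣p^k+2
... | inj₁ d∣p   = d∣p
... | inj₂ d∣p^k = ∣^suc⇒∣ k prime-d d∣p^k

h+h≡h*2 : ∀ h → h ℕ.+ h ≡ h ℕ.* 2
h+h≡h*2 h = trans (cong (h ℕ.+_) (sym (ℕ.+-identityʳ h))) (ℕ.*-comm 2 h)

oddPrimePower≢double : ∀ {q} → OddPrimePower q → ∀ h → q ≢ h ℕ.+ h
oddPrimePower≢double (p , k , prime-p , p≢2 , refl) h p^k+1≡h+h
  with prime⇒irreducible prime-p (∣^suc⇒∣ k prime[2] (divides h (trans p^k+1≡h+h (h+h≡h*2 h))))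
... | inj₁ ()
... | inj₂ 2≡p = p≢2 (sym 2≡p)

double/2≡ : ∀ h → (h ℕ.+ h) / 2 ≡ h
double/2≡ h = trans (cong (_/ 2) (h+h≡h*2 h)) (m*n/n≡m h 2)

-- If j were missed, f would factor through punchOut j : Fin (suc n) → Fin n.
injective⇒strictlySurjective : ∀ {n} {f : Fin n → Fin n} →
  Injective _≡_ _≡_ f → StrictlySurjective _≡_ f
injective⇒strictlySurjective {suc n} {f} f-inj j with Fin.any? (λ i → f i Fin.≟ j)
... | yes hit = hit
... | no miss =
  let i , i′ , i<i′ , same = Fin.pigeonhole (ℕ.n<1+n n) (λ i → punchOut (missed i))
  in ⊥-elim (Fin.<⇒≢ i<i′ (f-inj (Fin.punchOut-injective (missed i) (missed i′) same)))
  where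
    missed : ∀ i → j ≢ f i
    missed i j≡fi = miss (i , sym j≡fi)

injective⇒bijective : ∀ {n} → A ↔ Fin n → {f : A → A} →
  Injective _≡_ _≡_ f → Bijective _≡_ _≡_ f
injective⇒bijective enum {f} f-inj = f-inj , strictlySurjective⇒surjective f-onto
  where
    open Inverse enum using (to; from)
    to-injective : Injective _≡_ _≡_ to
    to-injective = Injection.injective (↔⇒↣ enum)
    from-injective : Injective _≡_ _≡_ from
    from-injective = Injection.injective (↔⇒↣ (↔-sym enum))
    f-onto : StrictlySurjective _≡_ f
    f-onto y with i , e ← injective⇒strictlySurjective {f = to ∘ f ∘ from}
                            (from-injective ∘ f-inj ∘ to-injective) (to y)
      = from i , to-injective e

∈-∃↭ : ∀ {x : A} {xs} → x ∈ xs → ∃ λ ys → xs ↭ x ∷ ys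
∈-∃↭ x∈xs with ys , zs , refl ← ∈-∃++ x∈xs = ys ++ zs , shift _ ys zs

∈-∃↭₂ : ∀ {x y : A} {xs} → x ∈ xs → y ∈ xs → y ≢ x → ∃ λ zs → xs ↭ x ∷ y ∷ zs
∈-∃↭₂ x∈xs y∈xs y≢x with ys , xs↭ ← ∈-∃↭ x∈xs with ∈-resp-↭ xs↭ y∈xs
... | here y≡x = ⊥-elim (y≢x y≡x)
... | there y∈ys with zs , ys↭ ← ∈-∃↭ y∈ys = zs , ↭-trans xs↭ (↭-prep _ ys↭)

Unique-resp-↭ : ∀ {xs ys : List A} → xs ↭ ys → Unique xs → Unique ys
Unique-resp-↭ {A = A} xs↭ys = Permutationₛ.Unique-resp-↭ (setoid A) (↭⇒↭ₛ xs↭ys)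

Unique-++-disjoint : ∀ (xs : List A) {ys x} → Unique (xs ++ ys) → x ∈ xs → x ∉ ys
Unique-++-disjoint (y ∷ xs) (y∉ ∷ _) (here refl) x∈ys = All.lookup y∉ (∈-++⁺ʳ xs x∈ys) refl
Unique-++-disjoint (y ∷ xs) (_ ∷ u)  (there x∈xs)    = Unique-++-disjoint xs u x∈xs

FixedPointFreeOn : (A → A) → List A → Set _
FixedPointFreeOn σ xs = ∀ {x} → x ∈ xs → σ x ≢ x

record IsInvolutionOn {a} {A : Set a} (σ : A → A) (xs : List A) : Set a where
  field
    closed     : ∀ {x} → x ∈ xs → σ x ∈ xs
    involutive : ∀ {x} → x ∈ xs → σ (σ x) ≡ x

module _ {σ : A → A} where
  open IsInvolutionOn

  IsInvolutionOn-complement : ∀ {xs} ys {zs} → Unique xs → xs ↭ ys ++ zs →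
    (∀ {y} → y ∈ ys → σ y ∈ ys) → IsInvolutionOn σ xs → IsInvolutionOn σ zs
  IsInvolutionOn-complement ys {zs} unique-xs xs↭ ys-closed σ-inv = record
    { closed     = closed′
    ; involutive = involutive σ-inv ∘ zs⊆xs
    }
    where
      zs⊆xs : ∀ {z} → z ∈ zs → z ∈ _
      zs⊆xs z∈zs = ∈-resp-↭ (↭-sym xs↭) (∈-++⁺ʳ ys z∈zs)
      closed′ : ∀ {z} → z ∈ zs → σ z ∈ zs
      closed′ z∈zs with ∈-++⁻ ys (∈-resp-↭ xs↭ (closed σ-inv (zs⊆xs z∈zs)))
      ... | inj₂ σz∈zs = σz∈zs
      ... | inj₁ σz∈ys = ⊥-elim (Unique-++-disjoint ys (Unique-resp-↭ xs↭ unique-xs)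
              (subst (_∈ ys) (involutive σ-inv (zs⊆xs z∈zs)) (ys-closed σz∈ys)) z∈zs)

  withPartners : List A → List A
  withPartners []       = []
  withPartners (x ∷ xs) = x ∷ σ x ∷ withPartners xs

  ∈-withPartners : ∀ {x xs} → x ∈ xs → x ∈ withPartners xs
  ∈-withPartners (here refl)  = here refl
  ∈-withPartners (there x∈xs) = there (there (∈-withPartners x∈xs))

  length-withPartners : ∀ xs → length (withPartners xs) ≡ length xs ℕ.+ length xs
  length-withPartners []       = refl
  length-withPartners (x ∷ xs) =
    cong suc (trans (cong suc (length-withPartners xs)) (sym (ℕ.+-suc (length xs) (length xs))))

  involution⇒↭-withPartners : ∀ xs → Unique xs → IsInvolutionOn σ xs → FixedPointFreeOn σ xs →
    ∃ λ ps → xs ↭ withPartners ps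
  involution⇒↭-withPartners xs = go xs (<-wellFounded (length xs))
    where
      go : ∀ xs → Acc _<_ (length xs) → Unique xs → IsInvolutionOn σ xs →
        FixedPointFreeOn σ xs → ∃ λ ps → xs ↭ withPartners ps
      go []       _         _        _     _    = [] , ↭-refl
      go (x ∷ xs) (acc rec) unique-x∷xs σ-inv no-fix = peel (∈-∃↭ σx∈xs)
        where
          σx∈xs : σ x ∈ xs
          σx∈xs with closed σ-inv (here refl)
          ... | here σx≡x   = ⊥-elim (no-fix (here refl) σx≡x)
          ... | there σx∈xs = σx∈xs
          pair-closed : ∀ {y} → y ∈ x ∷ σ x ∷ [] → σ y ∈ x ∷ σ x ∷ []
          pair-closed (here refl)         = there (here refl)
          pair-closed (there (here refl)) = here (involutive σ-inv (here refl))
          peel : (∃ λ ys → xs ↭ σ x ∷ ys) → ∃ λ ps → x ∷ xs ↭ withPartners ps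
          peel (ys , xs↭) =
            let ps , ys↭ = go ys (rec shorter) unique-ys σ-inv-ys no-fix-ys
            in x ∷ ps , ↭-trans x∷xs↭ (↭-prep x (↭-prep (σ x) ys↭))
            where
              x∷xs↭ : x ∷ xs ↭ x ∷ σ x ∷ ys
              x∷xs↭ = ↭-prep x xs↭
              shorter : length ys < suc (length xs)
              shorter = subst (λ n → length ys < suc n) (sym (↭-length xs↭)) (ℕ.m<n⇒m<1+n (ℕ.n<1+n _))
              unique-ys : Unique ys
              unique-ys with _ ∷ _ ∷ u ← Unique-resp-↭ x∷xs↭ unique-x∷xs = u
              σ-inv-ys : IsInvolutionOn σ ys
              σ-inv-ys = IsInvolutionOn-complement (x ∷ σ x ∷ []) unique-x∷xs x∷xs↭ pair-closed σ-inv
              no-fix-ys : FixedPointFreeOn σ ys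
              no-fix-ys y∈ys = no-fix (∈-resp-↭ (↭-sym x∷xs↭) (there (there y∈ys)))

  involution-even-length : ∀ {xs} → Unique xs → IsInvolutionOn σ xs → FixedPointFreeOn σ xs →
    ∃ λ h → length xs ≡ h ℕ.+ h
  involution-even-length {xs} unique σ-inv no-fix
    with ps , xs↭ ← involution⇒↭-withPartners xs unique σ-inv no-fix
    = length ps , trans (↭-length xs↭) (length-withPartners ps)

module _ {q : ℕ} (F : FiniteField q) where
  open FiniteField F
  open IsCommutativeRing isCommutativeRing
    using (+-identityˡ; +-identityʳ; +-assoc; +-comm; -‿inverseˡ; -‿inverseʳ;
           *-identityˡ; *-identityʳ; *-assoc; *-comm; zeroˡ; zeroʳ; *-isCommutativeMonoid)

  private
    commutativeRing : CommutativeRing _ _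
    commutativeRing = record { isCommutativeRing = isCommutativeRing }

  open import Algebra.Properties.Ring (CommutativeRing.ring commutativeRing)
    using (-‿involutive; -‿injective; -‿distribˡ-*; -‿distribʳ-*; -‿+-comm; -0#≈0#;
           +-cancelˡ; +-inverseˡ-unique)

  open Inverse enumeration using (to; from; strictlyInverseʳ)

  _≟_ : DecidableEquality Carrier
  _≟_ = Fin.inj⇒≟ (↔⇒↣ enumeration)

  open import Algebra.Solver.Ring.NaturalCoefficients.Default
    (CommutativeRing.commutativeSemiring commutativeRing)

  1≢0 : 1# ≢ 0#
  1≢0 = 0≢1 ∘ sym

  ⁻¹-inverseˡ : ∀ {x} → x ≢ 0# → x ⁻¹ * x ≡ 1#
  ⁻¹-inverseˡ {x} x≢0 = trans (*-comm (x ⁻¹) x) (⁻¹-inverse x x≢0)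

  *-cancelˡ : ∀ {x y z} → x ≢ 0# → x * y ≡ x * z → y ≡ z
  *-cancelˡ {x} {y} {z} x≢0 xy≡xz = begin
    y              ≡⟨ sym (*-identityˡ y) ⟩
    1# * y         ≡⟨ cong (_* y) (sym (⁻¹-inverseˡ x≢0)) ⟩
    x ⁻¹ * x * y   ≡⟨ *-assoc (x ⁻¹) x y ⟩
    x ⁻¹ * (x * y) ≡⟨ cong (x ⁻¹ *_) xy≡xz ⟩
    x ⁻¹ * (x * z) ≡⟨ sym (*-assoc (x ⁻¹) x z) ⟩
    x ⁻¹ * x * z   ≡⟨ cong (_* z) (⁻¹-inverseˡ x≢0) ⟩
    1# * z         ≡⟨ *-identityˡ z ⟩
    z              ∎
    where open ≡-Reasoning

  zero-product : ∀ {x y} → x * y ≡ 0# → x ≡ 0# ⊎ y ≡ 0#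
  zero-product {x} {y} xy≡0 with x ≟ 0#
  ... | yes x≡0 = inj₁ x≡0
  ... | no  x≢0 = inj₂ (*-cancelˡ x≢0 (trans xy≡0 (sym (zeroʳ x))))

  *-nonzero : ∀ {x y} → x ≢ 0# → y ≢ 0# → x * y ≢ 0#
  *-nonzero x≢0 y≢0 xy≡0 with zero-product xy≡0
  ... | inj₁ x≡0 = x≢0 x≡0
  ... | inj₂ y≡0 = y≢0 y≡0

  ⁻¹-nonzero : ∀ {x} → x ≢ 0# → x ⁻¹ ≢ 0#
  ⁻¹-nonzero {x} x≢0 x⁻¹≡0 =
    1≢0 (trans (sym (⁻¹-inverse x x≢0)) (trans (cong (x *_) x⁻¹≡0) (zeroʳ x)))

  difference-of-squares : ∀ {x y} → x * x ≡ y * y → (x + - y) * (x + y) ≡ 0#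
  difference-of-squares {x} {y} xx≡yy = begin
    (x + - y) * (x + y)
      ≡⟨ solve 3 (λ x y -y → (x :+ -y) :* (x :+ y) := x :* x :+ -y :* y :+ x :* (y :+ -y)) refl x y (- y) ⟩
    x * x + - y * y + x * (y + - y) ≡⟨ cong₂ (λ s t → s + - y * y + x * t) xx≡yy (-‿inverseʳ y) ⟩
    y * y + - y * y + x * 0#        ≡⟨ cong₂ (λ s t → y * y + s + t) (sym (-‿distribˡ-* y y)) (zeroʳ x) ⟩
    y * y + - (y * y) + 0#          ≡⟨ cong (_+ 0#) (-‿inverseʳ (y * y)) ⟩
    0# + 0#                         ≡⟨ +-identityʳ 0# ⟩
    0#                              ∎
    where open ≡-Reasoning

  square-roots : ∀ {x y} → x * x ≡ y * y → x ≡ y ⊎ x ≡ - y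
  square-roots {x} {y} xx≡yy with zero-product (difference-of-squares xx≡yy)
  ... | inj₁ x-y≡0 = inj₁ (trans (+-inverseˡ-unique x (- y) x-y≡0) (-‿involutive y))
  ... | inj₂ x+y≡0 = inj₂ (+-inverseˡ-unique x y x+y≡0)

  -x≢0 : ∀ {x} → x ≢ 0# → - x ≢ 0#
  -x≢0 {x} x≢0 -x≡0 = x≢0 (trans (sym (-‿involutive x)) (trans (cong -_ -x≡0) -0#≈0#))

  -x*-x≡x*x : ∀ x → - x * - x ≡ x * x
  -x*-x≡x*x x = begin
    - x * - x     ≡⟨ sym (-‿distribˡ-* x (- x)) ⟩
    - (x * - x)   ≡⟨ cong -_ (sym (-‿distribʳ-* x x)) ⟩
    - - (x * x)   ≡⟨ -‿involutive (x * x) ⟩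
    x * x         ∎
    where open ≡-Reasoning

  1^n≡1 : ∀ n → 1# ^ n ≡ 1#
  1^n≡1 zero    = refl
  1^n≡1 (suc n) = trans (*-identityˡ _) (1^n≡1 n)

  prod : List Carrier → Carrier
  prod = foldr _*_ 1#

  prod-↭ : ∀ {xs ys} → xs ↭ ys → prod xs ≡ prod ys
  prod-↭ xs↭ys = Permutationₛ.foldr-commMonoid (setoid Carrier) *-isCommutativeMonoid (↭⇒↭ₛ xs↭ys)

  prod-withPartners : ∀ {σ k} ps → (∀ {x} → x ∈ ps → x * σ x ≡ k) →
    prod (withPartners {σ = σ} ps) ≡ k ^ length ps
  prod-withPartners []       _       = refl
  prod-withPartners {σ} (x ∷ ps) paired =
    trans (sym (*-assoc x (σ x) _))
          (cong₂ _*_ (paired (here refl)) (prod-withPartners ps (paired ∘ there)))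

  involution-product : ∀ {σ k xs} → Unique xs → IsInvolutionOn σ xs → FixedPointFreeOn σ xs →
    (∀ {x} → x ∈ xs → x * σ x ≡ k) → ∃ λ h → length xs ≡ h ℕ.+ h × prod xs ≡ k ^ h
  involution-product {xs = xs} unique σ-inv no-fix paired
    with ps , xs↭ ← involution⇒↭-withPartners xs unique σ-inv no-fix
    = length ps
    , trans (↭-length xs↭) (length-withPartners ps)
    , trans (prod-↭ xs↭) (prod-withPartners ps (paired ∘ ∈-resp-↭ (↭-sym xs↭) ∘ ∈-withPartners))

  eval-+ₚ : ∀ u v c → eval (u +ₚ v) c ≡ eval u c + eval v c
  eval-+ₚ []      v       c = sym (+-identityˡ _)
  eval-+ₚ (a ∷ u) []      c = sym (+-identityʳ _)
  eval-+ₚ (a ∷ u) (b ∷ v) c = trans (cong (λ t → a + b + c * t) (eval-+ₚ u v c))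
    (solve 5 (λ a b c x y → a :+ b :+ c :* (x :+ y) := a :+ c :* x :+ (b :+ c :* y))
             refl a b c (eval u c) (eval v c))

  eval-scaleₚ : ∀ a u c → eval (scaleₚ a u) c ≡ a * eval u c
  eval-scaleₚ a []      c = sym (zeroʳ a)
  eval-scaleₚ a (b ∷ u) c = trans (cong (λ t → a * b + c * t) (eval-scaleₚ a u c))
    (solve 4 (λ a b c x → a :* b :+ c :* (a :* x) := a :* (b :+ c :* x)) refl a b c (eval u c))

  eval-*ₚ : ∀ u v c → eval (u *ₚ v) c ≡ eval u c * eval v c
  eval-*ₚ []      v c = sym (zeroˡ _)
  eval-*ₚ (a ∷ u) v c = begin
    eval (scaleₚ a v +ₚ (0# ∷ u *ₚ v)) c       ≡⟨ eval-+ₚ (scaleₚ a v) (0# ∷ u *ₚ v) c ⟩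
    eval (scaleₚ a v) c + (0# + c * eval (u *ₚ v) c)
      ≡⟨ cong₂ (λ s t → s + (0# + c * t)) (eval-scaleₚ a v c) (eval-*ₚ u v c) ⟩
    a * eval v c + (0# + c * (eval u c * eval v c))
      ≡⟨ solve 4 (λ a c x y → a :* y :+ (con 0 :+ c :* (x :* y)) := (a :+ c :* x) :* y)
                 refl a c (eval u c) (eval v c) ⟩
    (a + c * eval u c) * eval v c               ∎
    where open ≡-Reasoning

  eval--ₚ : ∀ u c → eval (-ₚ u) c ≡ - eval u c
  eval--ₚ []      c = sym -0#≈0#
  eval--ₚ (a ∷ u) c = begin
    - a + c * eval (-ₚ u) c ≡⟨ cong (λ t → - a + c * t) (eval--ₚ u c) ⟩
    - a + c * - eval u c    ≡⟨ cong (- a +_) (sym (-‿distribʳ-* c (eval u c))) ⟩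
    - a + - (c * eval u c)  ≡⟨ -‿+-comm a (c * eval u c) ⟩
    - (a + c * eval u c)    ∎
    where open ≡-Reasoning

  eval-constₚ : ∀ a c → eval (constₚ a) c ≡ a
  eval-constₚ a c = trans (cong (a +_) (zeroʳ c)) (+-identityʳ a)

  eval-Xpow : ∀ n c → eval (Xpow n) c ≡ c ^ n
  eval-Xpow zero    c = eval-constₚ 1# c
  eval-Xpow (suc n) c = trans (cong (λ t → 0# + c * t) (eval-Xpow n c)) (+-identityˡ _)

  m : ℕ
  m = (q ∸ 1) / 2

  eval-half-branch : ∀ w X {c s} → eval X c ≡ s →
    eval (constₚ half *ₚ w *ₚ (constₚ 1# +ₚ X)) c ≡ half * eval w c * (1# + s)
  eval-half-branch w X {c} {s} X≡s = begin
    eval (constₚ half *ₚ w *ₚ (constₚ 1# +ₚ X)) c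
      ≡⟨ eval-*ₚ (constₚ half *ₚ w) (constₚ 1# +ₚ X) c ⟩
    eval (constₚ half *ₚ w) c * eval (constₚ 1# +ₚ X) c
      ≡⟨ cong₂ _*_ (eval-*ₚ (constₚ half) w c) (eval-+ₚ (constₚ 1#) X c) ⟩
    eval (constₚ half) c * eval w c * (eval (constₚ 1#) c + eval X c)
      ≡⟨ cong₂ (λ h t → h * eval w c * t) (eval-constₚ half c) (cong₂ _+_ (eval-constₚ 1# c) X≡s) ⟩
    half * eval w c * (1# + s) ∎
    where open ≡-Reasoning

  eval-piecewise : ∀ u v c →
    eval (piecewise u v) c ≡ half * eval u c * (1# + c ^ m) + half * eval v c * (1# + - (c ^ m))
  eval-piecewise u v c =
    trans (eval-+ₚ (constₚ half *ₚ u *ₚ (constₚ 1# +ₚ Xhalf)) (constₚ half *ₚ v *ₚ (constₚ 1# +ₚ (-ₚ Xhalf))) c)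
    (cong₂ _+_
    (eval-half-branch u Xhalf (eval-Xpow m c))
    (eval-half-branch v (-ₚ Xhalf) (trans (eval--ₚ Xhalf c) (cong -_ (eval-Xpow m c)))))

  piecewise-at-0 : ∀ u v → eval u 0# ≡ 0# → eval v 0# ≡ 0# → eval (piecewise u v) 0# ≡ 0#
  piecewise-at-0 u v u0≡0 v0≡0 = begin
    eval (piecewise u v) 0#
      ≡⟨ eval-piecewise u v 0# ⟩
    half * eval u 0# * (1# + 0# ^ m) + half * eval v 0# * (1# + - (0# ^ m))
      ≡⟨ cong₂ (λ a b → half * a * (1# + 0# ^ m) + half * b * (1# + - (0# ^ m))) u0≡0 v0≡0 ⟩
    half * 0# * (1# + 0# ^ m) + half * 0# * (1# + - (0# ^ m))
      ≡⟨ solve 3 (λ h s t → h :* con 0 :* s :+ h :* con 0 :* t := con 0) refl half _ _ ⟩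
    0# ∎
    where open ≡-Reasoning

  elements : List Carrier
  elements = map from (allFin q)

  elements-unique : Unique elements
  elements-unique = Unique.map⁺ (Injection.injective (↔⇒↣ (↔-sym enumeration))) (Unique.allFin⁺ q)

  ∈-elements : ∀ x → x ∈ elements
  ∈-elements x = subst (_∈ elements) (strictlyInverseʳ x) (∈-map⁺ from (∈-allFin (to x)))

  length-elements : length elements ≡ q
  length-elements = trans (length-map from (allFin q)) (length-tabulate id)

  C₀? : ∀ c → Dec (C₀ c)
  C₀? c with Any.any? (λ e → ¬? (e ≟ 0#) ×-dec (c ≟ (e * e))) elements
  ... | yes root = yes (Any.satisfied root)
  ... | no  none = no λ (e , e≢0 , c≡ee) → none (Any.map (λ { refl → e≢0 , c≡ee }) (∈-elements e))

  classify : ∀ c → c ≡ 0# ⊎ C₀ c ⊎ C₁ c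
  classify c with c ≟ 0# | C₀? c
  ... | yes c≡0 | _         = inj₁ c≡0
  ... | no  c≢0 | yes c∈C₀ = inj₂ (inj₁ c∈C₀)
  ... | no  c≢0 | no  c∉C₀ = inj₂ (inj₂ (c≢0 , c∉C₀))

  C₀⇒≢0 : ∀ {c} → C₀ c → c ≢ 0#
  C₀⇒≢0 (e , e≢0 , c≡ee) c≡0 = *-nonzero e≢0 e≢0 (trans (sym c≡ee) c≡0)

  nonzeros : List Carrier
  nonzeros = proj₁ (∈-∃↭ (∈-elements 0#))

  elements↭ : elements ↭ 0# ∷ nonzeros
  elements↭ = proj₂ (∈-∃↭ (∈-elements 0#))

  nonzeros-unique : Unique nonzeros
  nonzeros-unique with _ ∷ unique ← Unique-resp-↭ elements↭ elements-unique = unique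

  ∈-nonzeros : ∀ {x} → x ≢ 0# → x ∈ nonzeros
  ∈-nonzeros {x} x≢0 with ∈-resp-↭ elements↭ (∈-elements x)
  ... | here x≡0      = ⊥-elim (x≢0 x≡0)
  ... | there x∈nonzeros = x∈nonzeros

  nonzeros-≢0 : ∀ {x} → x ∈ nonzeros → x ≢ 0#
  nonzeros-≢0 x∈nonzeros refl with 0∉nonzeros ∷ _ ← Unique-resp-↭ elements↭ elements-unique
    = All.lookup 0∉nonzeros x∈nonzeros refl

  m≡half-length : ∀ h → length nonzeros ≡ h ℕ.+ h → m ≡ h
  m≡half-length h len = trans (cong (λ n → (n ∸ 1) / 2) q≡) (double/2≡ h)
    where
      q≡ : q ≡ suc (h ℕ.+ h)
      q≡ = trans (sym length-elements) (trans (↭-length elements↭) (cong suc len))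

  partner : Carrier → Carrier → Carrier
  partner c y = c * y ⁻¹

  *-partner : ∀ {c y} → y ≢ 0# → y * partner c y ≡ c
  *-partner {c} {y} y≢0 = begin
    y * (c * y ⁻¹) ≡⟨ solve 3 (λ y c z → y :* (c :* z) := c :* (y :* z)) refl y c (y ⁻¹) ⟩
    c * (y * y ⁻¹) ≡⟨ cong (c *_) (⁻¹-inverse y y≢0) ⟩
    c * 1#         ≡⟨ *-identityʳ c ⟩
    c              ∎
    where open ≡-Reasoning

  partner-≢0 : ∀ {c y} → c ≢ 0# → y ≢ 0# → partner c y ≢ 0#
  partner-≢0 c≢0 y≢0 = *-nonzero c≢0 (⁻¹-nonzero y≢0)

  partner-fixed⇒square : ∀ {c y} → y ≢ 0# → partner c y ≡ y → y * y ≡ c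
  partner-fixed⇒square {y = y} y≢0 fixed = trans (cong (y *_) (sym fixed)) (*-partner y≢0)

  square⇒partner-fixed : ∀ {c y} → y ≢ 0# → y * y ≡ c → partner c y ≡ y
  square⇒partner-fixed y≢0 yy≡c = *-cancelˡ y≢0 (trans (*-partner y≢0) (sym yy≡c))

  partner-involution : ∀ {c} → c ≢ 0# → IsInvolutionOn (partner c) nonzeros
  partner-involution {c} c≢0 = record
    { closed     = λ y∈ → ∈-nonzeros (partner-≢0 c≢0 (nonzeros-≢0 y∈))
    ; involutive = λ y∈ → involutive (nonzeros-≢0 y∈)
    }
    where
      involutive : ∀ {y} → y ≢ 0# → partner c (partner c y) ≡ y
      involutive {y} y≢0 = *-cancelˡ p≢0
        (trans (*-partner p≢0) (sym (trans (*-comm (partner c y) y) (*-partner y≢0))))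
        where p≢0 = partner-≢0 c≢0 y≢0

  prod-nonzeros-C₁ : ∀ {c} → C₁ c → prod nonzeros ≡ c ^ m
  prod-nonzeros-C₁ {c} (c≢0 , c∉C₀) =
    let h , len , prod≡ = involution-product nonzeros-unique (partner-involution c≢0) no-fix
                            (λ y∈ → *-partner (nonzeros-≢0 y∈))
    in trans prod≡ (cong (c ^_) (sym (m≡half-length h len)))
    where
      no-fix : FixedPointFreeOn (partner c) nonzeros
      no-fix {y} y∈ fixed =
        c∉C₀ (y , nonzeros-≢0 y∈ , sym (partner-fixed⇒square (nonzeros-≢0 y∈) fixed))

  module _ (q-odd : OddPrimePower q) where

    -- Otherwise x ↦ x + 1 would pair up the q elements, making q even.
    1+1≢0 : 1# + 1# ≢ 0#
    1+1≢0 2≡0 =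
      let h , len = involution-even-length elements-unique shift-involution shift-no-fix
      in oddPrimePower≢double q-odd h (trans (sym length-elements) len)
      where
        shift-involution : IsInvolutionOn (_+ 1#) elements
        shift-involution = record
          { closed     = λ {x} _ → ∈-elements (x + 1#)
          ; involutive = λ {x} _ → trans (+-assoc x 1# 1#) (trans (cong (x +_) 2≡0) (+-identityʳ x))
          }
        shift-no-fix : FixedPointFreeOn (_+ 1#) elements
        shift-no-fix {x} _ x+1≡x = 1≢0 (+-cancelˡ x 1# 0# (trans x+1≡x (sym (+-identityʳ x))))

    -x≢x : ∀ {x} → x ≢ 0# → - x ≢ x
    -x≢x {x} x≢0 -x≡x = *-nonzero 1+1≢0 x≢0 (begin
      (1# + 1#) * x ≡⟨ solve 1 (λ x → (con 1 :+ con 1) :* x := x :+ x) refl x ⟩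
      x + x         ≡⟨ cong (_+ x) (sym -x≡x) ⟩
      - x + x       ≡⟨ -‿inverseˡ x ⟩
      0#            ∎)
      where open ≡-Reasoning

    nonzeros-↭-±roots : ∀ {e} → e ≢ 0# → ∃ λ rest → nonzeros ↭ e ∷ - e ∷ rest
    nonzeros-↭-±roots e≢0 = ∈-∃↭₂ (∈-nonzeros e≢0) (∈-nonzeros (-x≢0 e≢0)) (-x≢x e≢0)

    partner-pairs-off-±roots : ∀ {c e rest} → e ≢ 0# → c ≡ e * e → nonzeros ↭ e ∷ - e ∷ rest →
      ∃ λ h → length rest ≡ h ℕ.+ h × prod rest ≡ c ^ h
    partner-pairs-off-±roots {c} {e} {rest} e≢0 c≡ee nonzeros↭ =
      involution-product unique-rest partner-rest no-fix (λ y∈ → *-partner (rest-≢0 y∈))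
      where
        unique-±roots-rest : Unique (e ∷ - e ∷ rest)
        unique-±roots-rest = Unique-resp-↭ nonzeros↭ nonzeros-unique
        unique-rest : Unique rest
        unique-rest with _ ∷ _ ∷ unique ← unique-±roots-rest = unique
        ±roots-closed : ∀ {y} → y ∈ e ∷ - e ∷ [] → partner c y ∈ e ∷ - e ∷ []
        ±roots-closed (here refl)         = here (square⇒partner-fixed e≢0 (sym c≡ee))
        ±roots-closed (there (here refl)) =
          there (here (square⇒partner-fixed (-x≢0 e≢0) (trans (-x*-x≡x*x e) (sym c≡ee))))
        partner-rest : IsInvolutionOn (partner c) rest
        partner-rest = IsInvolutionOn-complement (e ∷ - e ∷ []) nonzeros-unique nonzeros↭ ±roots-closed
                         (partner-involution (C₀⇒≢0 (e , e≢0 , c≡ee)))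
        rest-≢0 : ∀ {y} → y ∈ rest → y ≢ 0#
        rest-≢0 y∈ = nonzeros-≢0 (∈-resp-↭ (↭-sym nonzeros↭) (there (there y∈)))
        no-fix : FixedPointFreeOn (partner c) rest
        no-fix y∈ fixed with square-roots (trans (partner-fixed⇒square (rest-≢0 y∈) fixed) c≡ee)
                           | unique-±roots-rest
        ... | inj₁ refl | e∉ ∷ _       = All.lookup e∉ (there y∈) refl
        ... | inj₂ refl | _ ∷ -e∉ ∷ _ = All.lookup -e∉ y∈ refl

    prod-nonzeros-C₀ : ∀ {c} → C₀ c → prod nonzeros ≡ - (c ^ m)
    prod-nonzeros-C₀ {c} (e , e≢0 , c≡ee) with rest , nonzeros↭ ← nonzeros-↭-±roots e≢0 =
      let h , len , prod≡ = partner-pairs-off-±roots e≢0 c≡ee nonzeros↭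
      in begin
        prod nonzeros         ≡⟨ prod-↭ nonzeros↭ ⟩
        e * (- e * prod rest) ≡⟨ cong (λ t → e * (- e * t)) prod≡ ⟩
        e * (- e * c ^ h)     ≡⟨ sym (*-assoc e (- e) (c ^ h)) ⟩
        e * - e * c ^ h       ≡⟨ cong (_* c ^ h) (sym (-‿distribʳ-* e e)) ⟩
        - (e * e) * c ^ h     ≡⟨ sym (-‿distribˡ-* (e * e) (c ^ h)) ⟩
        - (e * e * c ^ h)     ≡⟨ cong (λ t → - (t * c ^ h)) (sym c≡ee) ⟩
        - (c ^ suc h)         ≡⟨ cong (λ n → - (c ^ n)) (sym (m≡half-length (suc h) (length-nonzeros h len))) ⟩
        - (c ^ m)             ∎
      where
        open ≡-Reasoning
        length-nonzeros : ∀ h → length rest ≡ h ℕ.+ h → length nonzeros ≡ suc h ℕ.+ suc h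
        length-nonzeros h len =
          trans (↭-length nonzeros↭) (trans (cong (suc ∘ suc) len) (sym (ℕ.+-suc (suc h) h)))

    wilson : prod nonzeros ≡ - 1#
    wilson = trans (prod-nonzeros-C₀ (1# , 1≢0 , sym (*-identityˡ 1#))) (cong -_ (1^n≡1 m))

    euler-C₀ : ∀ {c} → C₀ c → c ^ m ≡ 1#
    euler-C₀ c∈C₀ = -‿injective (trans (sym (prod-nonzeros-C₀ c∈C₀)) wilson)

    euler-C₁ : ∀ {c} → C₁ c → c ^ m ≡ - 1#
    euler-C₁ c∈C₁ = trans (sym (prod-nonzeros-C₁ c∈C₁)) wilson

    half*2≡1 : half * (1# + 1#) ≡ 1#
    half*2≡1 = ⁻¹-inverseˡ 1+1≢0

    selectˡ : ∀ a b → half * a * (1# + 1#) + half * b * (1# + - 1#) ≡ a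
    selectˡ a b = begin
      half * a * (1# + 1#) + half * b * (1# + - 1#)
        ≡⟨ cong (λ t → half * a * (1# + 1#) + half * b * t) (-‿inverseʳ 1#) ⟩
      half * a * (1# + 1#) + half * b * 0#
        ≡⟨ solve 3 (λ h a b → h :* a :* (con 1 :+ con 1) :+ h :* b :* con 0 := a :* (h :* (con 1 :+ con 1)))
                   refl half a b ⟩
      a * (half * (1# + 1#)) ≡⟨ cong (a *_) half*2≡1 ⟩
      a * 1#                 ≡⟨ *-identityʳ a ⟩
      a                      ∎
      where open ≡-Reasoning

    piecewise-on-C₀ : ∀ u v {c} → C₀ c → eval (piecewise u v) c ≡ eval u c
    piecewise-on-C₀ u v {c} c∈C₀ = begin
      eval (piecewise u v) c
        ≡⟨ eval-piecewise u v c ⟩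
      half * eval u c * (1# + c ^ m) + half * eval v c * (1# + - (c ^ m))
        ≡⟨ cong (λ s → half * eval u c * (1# + s) + half * eval v c * (1# + - s)) (euler-C₀ c∈C₀) ⟩
      half * eval u c * (1# + 1#) + half * eval v c * (1# + - 1#)
        ≡⟨ selectˡ (eval u c) (eval v c) ⟩
      eval u c ∎
      where open ≡-Reasoning

    piecewise-on-C₁ : ∀ u v {c} → C₁ c → eval (piecewise u v) c ≡ eval v c
    piecewise-on-C₁ u v {c} c∈C₁ = begin
      eval (piecewise u v) c
        ≡⟨ eval-piecewise u v c ⟩
      half * eval u c * (1# + c ^ m) + half * eval v c * (1# + - (c ^ m))
        ≡⟨ cong (λ s → half * eval u c * (1# + s) + half * eval v c * (1# + - s)) (euler-C₁ c∈C₁) ⟩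
      half * eval u c * (1# + - 1#) + half * eval v c * (1# + - - 1#)
        ≡⟨ cong (λ t → half * eval u c * (1# + - 1#) + half * eval v c * (1# + t)) (-‿involutive 1#) ⟩
      half * eval u c * (1# + - 1#) + half * eval v c * (1# + 1#)
        ≡⟨ +-comm _ _ ⟩
      half * eval v c * (1# + 1#) + half * eval u c * (1# + - 1#)
        ≡⟨ selectˡ (eval v c) (eval u c) ⟩
      eval v c ∎
      where open ≡-Reasoning

    PermutationCriterion : Poly → Poly → Set
    PermutationCriterion f₀ f₁ =
      InjectiveOn C₀ f₀ × InjectiveOn C₁ f₁
      × (∀ c → C₀ c → eval f₀ c ≢ 0#) × (∀ c → C₁ c → eval f₁ c ≢ 0#)
      × (∀ a b → C₀ a → C₁ b → eval f₀ a ≢ eval f₁ b)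

    module _ (f₀ f₁ : Poly) (f0≡0 : eval (piecewise f₀ f₁) 0# ≡ 0#) where

      f-on-C₀ : ∀ {c} → C₀ c → eval (piecewise f₀ f₁) c ≡ eval f₀ c
      f-on-C₀ = piecewise-on-C₀ f₀ f₁

      f-on-C₁ : ∀ {c} → C₁ c → eval (piecewise f₀ f₁) c ≡ eval f₁ c
      f-on-C₁ = piecewise-on-C₁ f₀ f₁

      permutation⇒criterion : IsPermutationPolynomial (piecewise f₀ f₁) → PermutationCriterion f₀ f₁
      permutation⇒criterion (injective , _) =
          (λ a b a∈C₀ b∈C₀ f₀a≡f₀b → injective (trans (f-on-C₀ a∈C₀) (trans f₀a≡f₀b (sym (f-on-C₀ b∈C₀)))))
        , (λ a b a∈C₁ b∈C₁ f₁a≡f₁b → injective (trans (f-on-C₁ a∈C₁) (trans f₁a≡f₁b (sym (f-on-C₁ b∈C₁)))))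
        , (λ c c∈C₀ f₀c≡0 → C₀⇒≢0 c∈C₀ (injective (trans (f-on-C₀ c∈C₀) (trans f₀c≡0 (sym f0≡0)))))
        , (λ c c∈C₁ f₁c≡0 → proj₁ c∈C₁ (injective (trans (f-on-C₁ c∈C₁) (trans f₁c≡0 (sym f0≡0)))))
        , (λ a b a∈C₀ b∈C₁ f₀a≡f₁b → proj₂ b∈C₁
             (subst C₀ (injective (trans (f-on-C₀ a∈C₀) (trans f₀a≡f₁b (sym (f-on-C₁ b∈C₁))))) a∈C₀))

      criterion⇒permutation : PermutationCriterion f₀ f₁ → IsPermutationPolynomial (piecewise f₀ f₁)
      criterion⇒permutation (injective₀ , injective₁ , f₀≢0 , f₁≢0 , separated) =
        injective⇒bijective enumeration injective
        where
          f≢0 : ∀ {c} → C₀ c ⊎ C₁ c → eval (piecewise f₀ f₁) c ≢ 0#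
          f≢0 (inj₁ c∈C₀) fc≡0 = f₀≢0 _ c∈C₀ (trans (sym (f-on-C₀ c∈C₀)) fc≡0)
          f≢0 (inj₂ c∈C₁) fc≡0 = f₁≢0 _ c∈C₁ (trans (sym (f-on-C₁ c∈C₁)) fc≡0)
          f-separated : ∀ {a b} → C₀ a → C₁ b → eval (piecewise f₀ f₁) a ≢ eval (piecewise f₀ f₁) b
          f-separated a∈C₀ b∈C₁ fa≡fb =
            separated _ _ a∈C₀ b∈C₁ (trans (sym (f-on-C₀ a∈C₀)) (trans fa≡fb (f-on-C₁ b∈C₁)))
          injective : Injective _≡_ _≡_ (eval (piecewise f₀ f₁))
          injective {a} {b} fa≡fb with classify a | classify b
          ... | inj₁ a≡0  | inj₁ b≡0  = trans a≡0 (sym b≡0)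
          ... | inj₁ refl | inj₂ b∈  = ⊥-elim (f≢0 b∈ (trans (sym fa≡fb) f0≡0))
          ... | inj₂ a∈  | inj₁ refl = ⊥-elim (f≢0 a∈ (trans fa≡fb f0≡0))
          ... | inj₂ (inj₁ a∈C₀) | inj₂ (inj₁ b∈C₀) =
            injective₀ a b a∈C₀ b∈C₀ (trans (sym (f-on-C₀ a∈C₀)) (trans fa≡fb (f-on-C₀ b∈C₀)))
          ... | inj₂ (inj₁ a∈C₀) | inj₂ (inj₂ b∈C₁) = ⊥-elim (f-separated a∈C₀ b∈C₁ fa≡fb)
          ... | inj₂ (inj₂ a∈C₁) | inj₂ (inj₁ b∈C₀) = ⊥-elim (f-separated b∈C₀ a∈C₁ (sym fa≡fb))
          ... | inj₂ (inj₂ a∈C₁) | inj₂ (inj₂ b∈C₁) =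
            injective₁ a b a∈C₁ b∈C₁ (trans (sym (f-on-C₁ a∈C₁)) (trans fa≡fb (f-on-C₁ b∈C₁)))

      inverse-by-classes : ∀ g → eval g 0# ≡ 0# →
        (∀ c → C₀ c → eval g (eval f₀ c) ≡ c) → (∀ c → C₁ c → eval g (eval f₁ c) ≡ c) →
        IsInverseOn g (piecewise f₀ f₁)
      inverse-by-classes g g0≡0 g-C₀ g-C₁ c with classify c
      ... | inj₁ refl        = trans (cong (eval g) f0≡0) g0≡0
      ... | inj₂ (inj₁ c∈C₀) = trans (cong (eval g) (f-on-C₀ c∈C₀)) (g-C₀ c c∈C₀)
      ... | inj₂ (inj₂ c∈C₁) = trans (cong (eval g) (f-on-C₁ c∈C₁)) (g-C₁ c c∈C₁)

      piecewise-inverse : ∀ g₀ g₁ → IsPartialInverse g₀ f₀ C₀ → IsPartialInverse g₁ f₁ C₁ →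
        MapsInto f₀ C₀ C₀ × MapsInto f₁ C₁ C₁ → IsInverseOn (piecewise g₀ g₁) (piecewise f₀ f₁)
      piecewise-inverse g₀ g₁ (g₀0≡0 , g₀∘f₀) (g₁0≡0 , g₁∘f₁) (f₀-C₀ , f₁-C₁) =
        inverse-by-classes (piecewise g₀ g₁) (piecewise-at-0 g₀ g₁ g₀0≡0 g₁0≡0)
          (λ c c∈C₀ → trans (piecewise-on-C₀ g₀ g₁ (f₀-C₀ c c∈C₀)) (g₀∘f₀ c c∈C₀))
          (λ c c∈C₁ → trans (piecewise-on-C₁ g₀ g₁ (f₁-C₁ c c∈C₁)) (g₁∘f₁ c c∈C₁))

      piecewise-inverse-swapped : ∀ g₀ g₁ → IsPartialInverse g₀ f₀ C₀ → IsPartialInverse g₁ f₁ C₁ →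
        MapsInto f₀ C₀ C₁ × MapsInto f₁ C₁ C₀ → IsInverseOn (piecewise g₁ g₀) (piecewise f₀ f₁)
      piecewise-inverse-swapped g₀ g₁ (g₀0≡0 , g₀∘f₀) (g₁0≡0 , g₁∘f₁) (f₀-C₁ , f₁-C₀) =
        inverse-by-classes (piecewise g₁ g₀) (piecewise-at-0 g₁ g₀ g₁0≡0 g₀0≡0)
          (λ c c∈C₀ → trans (piecewise-on-C₁ g₁ g₀ (f₀-C₁ c c∈C₀)) (g₀∘f₀ c c∈C₀))
          (λ c c∈C₁ → trans (piecewise-on-C₀ g₁ g₀ (f₁-C₀ c c∈C₁)) (g₁∘f₁ c c∈C₁))

lemma2 : {q : ℕ} (F : FiniteField q) → OddPrimePower q →
    let open FiniteField F in
    (f₀ f₁ : Poly) → eval (piecewise f₀ f₁) 0# ≡ 0# →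
      (IsPermutationPolynomial (piecewise f₀ f₁) ⇔
        (InjectiveOn C₀ f₀ × InjectiveOn C₁ f₁
         × (∀ c → C₀ c → eval f₀ c ≢ 0#) × (∀ c → C₁ c → eval f₁ c ≢ 0#)
         × (∀ a b → C₀ a → C₁ b → eval f₀ a ≢ eval f₁ b)))
      × (IsPermutationPolynomial (piecewise f₀ f₁) →
          (g₀ g₁ : Poly) → IsPartialInverse g₀ f₀ C₀ → IsPartialInverse g₁ f₁ C₁ →
            ((MapsInto f₀ C₀ C₀ × MapsInto f₁ C₁ C₁ →
                IsInverseOn (piecewise g₀ g₁) (piecewise f₀ f₁))
             × (MapsInto f₀ C₀ C₁ × MapsInto f₁ C₁ C₀ →
                IsInverseOn (piecewise g₁ g₀) (piecewise f₀ f₁))))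
lemma2 F q-odd f₀ f₁ f0≡0 =
  mk⇔ (permutation⇒criterion F q-odd f₀ f₁ f0≡0) (criterion⇒permutation F q-odd f₀ f₁ f0≡0) ,
  λ _ g₀ g₁ g₀-inverse g₁-inverse →
    piecewise-inverse F q-odd f₀ f₁ f0≡0 g₀ g₁ g₀-inverse g₁-inverse ,
    piecewise-inverse-swapped F q-odd f₀ f₁ f0≡0 g₀ g₁ g₀-inverse g₁-inverse
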